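{- Let $p$ be an odd prime, $n\geq1$, and let $1\leq N\leq\binom{n+1}{2}$. Let $d_1,\dots,d_N$ be chosen independently and uniformly at random from $\mathbb F_p^n$. Then the probability that the vectors $\varphi(d_1),\dots,\varphi(d_N)$ are linearly independent in $\mathbb F_p^{\binom{n+1}{2}}$ is at least \[\big(1-\mathbb P_{d\in\mathbb F_p^n}(\varphi(d)\in W_N)\big)^N,\] where $d$ is uniform in $\mathbb F_p^n$.
   Context: $\varphi:\mathbb F_p^n\to\mathbb F_p^{\binom{n+1}{2}}$ is the degree 2 Veronese map $(d_1,\dots,d_n)\mapsto(d_id_j)_{1\leq i\leq j\leq n}$. For $1\leq k\leq\binom{n+1}{2}$, $W_k$ denotes a $k$-dimensional subspace of $\mathbb F_p^{\binom{n+1}{2}}$ such that $|W_k\cap\operatorname{Im}\varphi|$ is maximal among all $k$-dimensional subspaces $W$ of $\mathbb F_p^{\binom{n+1}{2}}$ of the quantity $|W\cap\operatorname{Im}\varphi|$. -}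

module Defs where

open import Data.Nat using (ℕ; zero; suc; _+_; _*_; NonZero)
open import Data.Nat.DivMod using (_mod_)
open import Data.Fin using (Fin; toℕ; _≟_)
open import Data.Fin.Properties using (all?; any?)
open import Data.Vec using (Vec; []; _∷_; map; zipWith; replicate; _++_)
open import Data.Vec.Properties using (≡-dec)
open import Data.List using (List; [_]; concatMap; allFin; filter; length)
import Data.List as L
open import Data.Product using (∃; _,_; proj₁; proj₂)
open import Relation.Nullary using (Dec; yes; no; ¬_)
open import Relation.Nullary.Decidable using (map′; _→-dec_; _×-dec_)
open import Relation.Unary using (Decidable)
open import Relation.Binary.PropositionalEquality using (_≡_)

module _ (p : ℕ) .{{_ : NonZero p}} where

  0ₚ : Fin p
  0ₚ = 0 mod p

  _+ₚ_ : Fin p → Fin p → Fin p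
  a +ₚ b = (toℕ a + toℕ b) mod p

  _*ₚ_ : Fin p → Fin p → Fin p
  a *ₚ b = (toℕ a * toℕ b) mod p

  zeroV : (m : ℕ) → Vec (Fin p) m
  zeroV m = replicate m 0ₚ

  _+V_ : {m : ℕ} → Vec (Fin p) m → Vec (Fin p) m → Vec (Fin p) m
  _+V_ = zipWith _+ₚ_

  _·V_ : {m : ℕ} → Fin p → Vec (Fin p) m → Vec (Fin p) m
  c ·V v = map (c *ₚ_) v

  lincomb : {m k : ℕ} → Vec (Fin p) k → Vec (Vec (Fin p) m) k → Vec (Fin p) m
  lincomb {m} []       []       = zeroV m
  lincomb     (c ∷ cs) (v ∷ vs) = (c ·V v) +V lincomb cs vs

  LinIndep : {m k : ℕ} → Vec (Vec (Fin p) m) k → Set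
  LinIndep {m} {k} vs = ∀ (c : Vec (Fin p) k) → lincomb c vs ≡ zeroV m → c ≡ zeroV k

  InSpan : {m k : ℕ} → Vec (Vec (Fin p) m) k → Vec (Fin p) m → Set
  InSpan {m} {k} B v = ∃ λ (c : Vec (Fin p) k) → lincomb c B ≡ v

  -- tri n = binom(n+1, 2), the number of pairs 1 ≤ i ≤ j ≤ n
  tri : ℕ → ℕ
  tri zero    = zero
  tri (suc n) = suc n + tri n

  -- Degree-2 Veronese map  (d_1,…,d_n) ↦ (d_i d_j)_{i ≤ j}
  -- (coordinates listed as (1,1),(1,2),…,(1,n),(2,2),…,(n,n))
  φ : {n : ℕ} → Vec (Fin p) n → Vec (Fin p) (tri n)
  φ []       = []
  φ (x ∷ xs) = ((x *ₚ x) ∷ map (x *ₚ_) xs) ++ φ xs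

  InImφ : {n : ℕ} → Vec (Fin p) (tri n) → Set
  InImφ {n} v = ∃ λ (d : Vec (Fin p) n) → φ d ≡ v

  vecsOver : {A : Set} → List A → (m : ℕ) → List (Vec A m)
  vecsOver xs zero    = [ [] ]
  vecsOver xs (suc m) = concatMap (λ x → L.map (x ∷_) (vecsOver xs m)) xs

  allVecs : (m : ℕ) → List (Vec (Fin p) m)
  allVecs = vecsOver (allFin p)

  count : {A : Set} {P : A → Set} → Decidable P → List A → ℕ
  count P? xs = length (filter P? xs)

  allV? : {m : ℕ} {P : Vec (Fin p) m → Set} → Decidable P → Dec (∀ v → P v)
  allV? {zero}  P? with P? []
  ... | yes q = yes λ { [] → q }
  ... | no ¬q = no λ f → ¬q (f [])
  allV? {suc m} P? =
    map′ (λ f → λ { (x ∷ v) → f x v }) (λ f x v → f (x ∷ v))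
         (all? (λ x → allV? (λ v → P? (x ∷ v))))

  anyV? : {m : ℕ} {P : Vec (Fin p) m → Set} → Decidable P → Dec (∃ P)
  anyV? {zero}  P? with P? []
  ... | yes q = yes ([] , q)
  ... | no ¬q = no λ { ([] , q) → ¬q q }
  anyV? {suc m} P? =
    map′ (λ { (x , v , q) → (x ∷ v) , q }) (λ { ((x ∷ v) , q) → x , v , q })
         (any? (λ x → anyV? (λ v → P? (x ∷ v))))

  _≟V_ : {m : ℕ} (u v : Vec (Fin p) m) → Dec (u ≡ v)
  _≟V_ = ≡-dec _≟_

  linIndep? : {m k : ℕ} (vs : Vec (Vec (Fin p) m) k) → Dec (LinIndep vs)
  linIndep? {m} {k} vs = allV? (λ c → (lincomb c vs ≟V zeroV m) →-dec (c ≟V zeroV k))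

  inSpan? : {m k : ℕ} (B : Vec (Vec (Fin p) m) k) → Decidable (InSpan B)
  inSpan? B v = anyV? (λ c → lincomb c B ≟V v)

  inImφ? : {n : ℕ} → Decidable (InImφ {n})
  inImφ? v = anyV? (λ d → φ d ≟V v)

  -- Quantities in the statement.  A k-dimensional subspace W of
  -- F_p^{tri n} is given by a basis B (a linearly independent family
  -- of k vectors); W = span B.

  imHits : (n : ℕ) {k : ℕ} → Vec (Vec (Fin p) (tri n)) k → ℕ
  imHits n B = count (λ v → inSpan? B v ×-dec inImφ? {n} v) (allVecs (tri n))

  -- |{ d ∈ F_p^n : φ(d) ∈ W }|  (= p^n · P_d(φ(d) ∈ W))
  preimCount : (n : ℕ) {k : ℕ} → Vec (Vec (Fin p) (tri n)) k → ℕ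
  preimCount n B = count (λ d → inSpan? B (φ d)) (allVecs n)

  -- |{ (d_1,…,d_N) ∈ (F_p^n)^N : φ(d_1),…,φ(d_N) linearly independent }|
  -- (= p^{nN} · probability)
  indepCount : (n N : ℕ) → ℕ
  indepCount n N = count (λ ds → linIndep? (map φ ds)) (vecsOver (allVecs n) N)

-- Since p is odd, φ(d) = φ(e) iff e = ±d, so φ is two-to-one away from 0 and φ⁻¹(0) = {0}.
-- Hence #{d : φ(d) ∈ W} = 2·|W ∩ Im φ| − 1 for every subspace W, and a W_N maximising |W ∩ Im φ|
-- also maximises the preimage count against every subspace of dimension ≤ N (extend a basis).
-- Choose d₁, …, d_N one at a time: while φ(d₁), …, φ(d_k) (k < N) are independent, any d with
-- φ(d) outside their span keeps them independent, and there are at least p^n − #{d : φ(d) ∈ W_N}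
-- such d. Multiplying gives the claim, stated with counts rather than probabilities.

module Submission where

open import Defs
open import Algebra.Bundles using (CommutativeRing)
open import Algebra.Consequences.Propositional using (comm∧idˡ⇒id; comm∧invˡ⇒inv; comm∧distrˡ⇒distrʳ)
open import Algebra.Structures using (IsCommutativeRing)
open import Data.Bool using (if_then_else_)
open import Data.Empty using (⊥; ⊥-elim)
open import Data.Fin using (Fin; zero; suc; toℕ)
import Data.Fin as Fin
open import Data.Fin.Properties using (toℕ-injective; toℕ-fromℕ<; toℕ<n)
import Data.Fin.Properties as Finₚ
open import Data.List using (List; []; _∷_; allFin)
import Data.List as List
open import Data.List.Properties using (map-tabulate; length-tabulate)
open import Data.Nat
  using (ℕ; zero; suc; _+_; _*_; _^_; _∸_; _%_; _≤_; _<_; z≤n; s≤s; NonZero; ≢-nonZero; nonTrivial⇒n>1)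
open import Data.Nat.Coprimality using (prime⇒coprime; coprime-Bézout)
open import Data.Nat.DivMod
  using (_mod_; %-distribˡ-+; %-distribˡ-*; m<n⇒m%n≡m; n%n≡0; m*n%n≡0; m%n<n; %-remove-+ʳ)
open import Data.Nat.Divisibility using (_∣_; _∣0; ∣⇒≤; divides; m%n≡0⇒n∣m; n∣m⇒m%n≡0)
open import Data.Nat.GCD using (module Bézout)
open import Data.Nat.Primality using (Prime; euclidsLemma; prime⇒nonTrivial)
import Data.Nat.Properties as ℕ
open import Algebra.Properties.CommutativeSemigroup ℕ.+-commutativeSemigroup
  using () renaming (interchange to +-interchange)
open import Data.Product using (∃; _×_; _,_; proj₁; uncurry)
open import Data.Sum using (_⊎_; inj₁; inj₂)
import Data.Sum as Sum
open import Data.Vec using (Vec; []; _∷_; map; replicate; _++_)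
open import Data.Vec.Properties
  using (∷-injectiveˡ; ∷-injectiveʳ; ≡-dec; map-∘; map-cong; map-id; map-replicate; ++-injective)
open import Relation.Binary.Definitions using (DecidableEquality)
open import Relation.Binary.PropositionalEquality
open import Relation.Binary.PropositionalEquality.Algebra using (isMagma)
open import Relation.Nullary using (Dec; yes; no; ¬_; does)
open import Relation.Nullary.Decidable using (_×-dec_; _⊎-dec_; ¬?; decidable-stable)
open import Relation.Unary using (Decidable; _⊆_)

∑ : {A : Set} → List A → (A → ℕ) → ℕ
∑ []       f = 0
∑ (x ∷ xs) f = f x + ∑ xs f

syntax ∑ xs (λ x → e) = ∑[ x ∈ xs ] e

module _ {A : Set} where

  ∑-cong : (xs : List A) {f g : A → ℕ} → (∀ x → f x ≡ g x) → ∑ xs f ≡ ∑ xs g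
  ∑-cong []       f≗g = refl
  ∑-cong (x ∷ xs) f≗g = cong₂ _+_ (f≗g x) (∑-cong xs f≗g)

  ∑-mono-≤ : (xs : List A) {f g : A → ℕ} → (∀ x → f x ≤ g x) → ∑ xs f ≤ ∑ xs g
  ∑-mono-≤ []       f≤g = z≤n
  ∑-mono-≤ (x ∷ xs) f≤g = ℕ.+-mono-≤ (f≤g x) (∑-mono-≤ xs f≤g)

  ∑-zero : (xs : List A) {f : A → ℕ} → (∀ x → f x ≡ 0) → ∑ xs f ≡ 0
  ∑-zero []       f≗0 = refl
  ∑-zero (x ∷ xs) f≗0 = cong₂ _+_ (f≗0 x) (∑-zero xs f≗0)

  ∑-const : (xs : List A) (c : ℕ) → ∑[ _ ∈ xs ] c ≡ List.length xs * c
  ∑-const []       c = refl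
  ∑-const (x ∷ xs) c = cong (c +_) (∑-const xs c)

  ∑-+ : (xs : List A) (f g : A → ℕ) → ∑[ x ∈ xs ] (f x + g x) ≡ ∑ xs f + ∑ xs g
  ∑-+ []       f g = refl
  ∑-+ (x ∷ xs) f g = trans (cong (f x + g x +_) (∑-+ xs f g)) (+-interchange (f x) (g x) (∑ xs f) (∑ xs g))

  ∑-*ˡ : (xs : List A) (a : ℕ) (f : A → ℕ) → ∑[ x ∈ xs ] (a * f x) ≡ a * ∑ xs f
  ∑-*ˡ []       a f = sym (ℕ.*-zeroʳ a)
  ∑-*ˡ (x ∷ xs) a f = trans (cong (a * f x +_) (∑-*ˡ xs a f)) (sym (ℕ.*-distribˡ-+ a (f x) (∑ xs f)))

  ∑-*ʳ : (xs : List A) (f : A → ℕ) (a : ℕ) → ∑[ x ∈ xs ] (f x * a) ≡ ∑ xs f * a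
  ∑-*ʳ []       f a = refl
  ∑-*ʳ (x ∷ xs) f a = trans (cong (f x * a +_) (∑-*ʳ xs f a)) (sym (ℕ.*-distribʳ-+ a (f x) (∑ xs f)))

  ∑-++ : (xs ys : List A) (f : A → ℕ) → ∑ (xs List.++ ys) f ≡ ∑ xs f + ∑ ys f
  ∑-++ []       ys f = refl
  ∑-++ (x ∷ xs) ys f = trans (cong (f x +_) (∑-++ xs ys f)) (sym (ℕ.+-assoc (f x) (∑ xs f) (∑ ys f)))

∑-map : {A B : Set} (g : A → B) (xs : List A) (f : B → ℕ) → ∑ (List.map g xs) f ≡ ∑[ x ∈ xs ] f (g x)
∑-map g []       f = refl
∑-map g (x ∷ xs) f = cong (f (g x) +_) (∑-map g xs f)

∑-concatMap : {A B : Set} (h : A → List B) (xs : List A) (f : B → ℕ) →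
              ∑ (List.concatMap h xs) f ≡ ∑[ x ∈ xs ] ∑ (h x) f
∑-concatMap h []       f = refl
∑-concatMap h (x ∷ xs) f = trans (∑-++ (h x) (List.concatMap h xs) f) (cong (∑ (h x) f +_) (∑-concatMap h xs f))

∑-comm : {A B : Set} (xs : List A) (ys : List B) (f : A → B → ℕ) →
         ∑[ x ∈ xs ] ∑ ys (f x) ≡ ∑[ y ∈ ys ] ∑[ x ∈ xs ] f x y
∑-comm []       ys f = sym (∑-zero ys (λ _ → refl))
∑-comm (x ∷ xs) ys f = trans (cong (∑ ys (f x) +_) (∑-comm xs ys f)) (sym (∑-+ ys (f x) _))

𝟙 : {P : Set} → Dec P → ℕ
𝟙 P? = if does P? then 1 else 0

private
  variable
    P Q R : Set

𝟙-yes : (P? : Dec P) → P → 𝟙 P? ≡ 1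
𝟙-yes (yes _) _  = refl
𝟙-yes (no ¬p) p = ⊥-elim (¬p p)

𝟙-no : (P? : Dec P) → ¬ P → 𝟙 P? ≡ 0
𝟙-no (yes p) ¬p = ⊥-elim (¬p p)
𝟙-no (no _)  _  = refl

𝟙-mono : (P? : Dec P) (Q? : Dec Q) → (P → Q) → 𝟙 P? ≤ 𝟙 Q?
𝟙-mono (yes p) Q? P⇒Q = ℕ.≤-reflexive (sym (𝟙-yes Q? (P⇒Q p)))
𝟙-mono (no _)  Q? P⇒Q = z≤n

𝟙-cong : (P? : Dec P) (Q? : Dec Q) → (P → Q) → (Q → P) → 𝟙 P? ≡ 𝟙 Q?
𝟙-cong P? Q? P⇒Q Q⇒P = ℕ.≤-antisym (𝟙-mono P? Q? P⇒Q) (𝟙-mono Q? P? Q⇒P)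

𝟙-× : (P? : Dec P) (Q? : Dec Q) → 𝟙 (P? ×-dec Q?) ≡ 𝟙 P? * 𝟙 Q?
𝟙-× (yes _) (yes _) = refl
𝟙-× (yes _) (no _)  = refl
𝟙-× (no _)  Q?      = refl

𝟙-⊎ : (P? : Dec P) (Q? : Dec Q) → ¬ (P × Q) → 𝟙 (P? ⊎-dec Q?) ≡ 𝟙 P? + 𝟙 Q?
𝟙-⊎ (yes p) (yes q) ¬p×q = ⊥-elim (¬p×q (p , q))
𝟙-⊎ (yes _) (no _)  _    = refl
𝟙-⊎ (no _)  (yes _) _    = refl
𝟙-⊎ (no _)  (no _)  _    = refl

𝟙-+-¬ : (P? : Dec P) → 𝟙 P? + 𝟙 (¬? P?) ≡ 1
𝟙-+-¬ (yes _) = refl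
𝟙-+-¬ (no _)  = refl

𝟙-*-≤ : (P? : Dec P) (Q? : Dec Q) (R? : Dec R) → (P → Q → R) → 𝟙 P? * 𝟙 Q? ≤ 𝟙 R?
𝟙-*-≤ (yes p) (yes q) R? P⇒Q⇒R = 𝟙-mono (yes p) R? (λ p → P⇒Q⇒R p q)
𝟙-*-≤ (yes _) (no _)  R? _     = z≤n
𝟙-*-≤ (no _)  Q?      R? _     = z≤n

module Enumeration {A : Set} (_≟_ : DecidableEquality A) where

  Enumerates : List A → Set
  Enumerates xs = ∀ y → ∑[ x ∈ xs ] 𝟙 (x ≟ y) ≡ 1

  module _ (xs : List A) (enum : Enumerates xs) where

    ∑-select : (y : A) (g : A → ℕ) → ∑[ x ∈ xs ] (𝟙 (x ≟ y) * g x) ≡ g y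
    ∑-select y g = trans (collapse xs) (trans (cong (_* g y) (enum y)) (ℕ.+-identityʳ (g y)))
      where
      collapse : (zs : List A) → ∑[ x ∈ zs ] (𝟙 (x ≟ y) * g x) ≡ ∑[ x ∈ zs ] 𝟙 (x ≟ y) * g y
      collapse []       = refl
      collapse (z ∷ zs) with z ≟ y
      ... | yes refl = cong₂ _+_ (ℕ.+-identityʳ (g z)) (collapse zs)
      ... | no _     = collapse zs

    enumerates-sym : (y : A) → ∑[ x ∈ xs ] 𝟙 (y ≟ x) ≡ 1
    enumerates-sym y = trans (∑-cong xs (λ x → 𝟙-cong (y ≟ x) (x ≟ y) sym sym)) (enum y)

    ∑-𝟙-witness : {P : A → Set} (P? : Decidable P) {y : A} → P y → 1 ≤ ∑[ x ∈ xs ] 𝟙 (P? x)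
    ∑-𝟙-witness P? {y} py = subst (_≤ ∑[ x ∈ xs ] 𝟙 (P? x)) (enum y)
      (∑-mono-≤ xs (λ x → 𝟙-mono (x ≟ y) (P? x) (λ { refl → py })))

open Enumeration

allFin-enumerates : (n : ℕ) → Enumerates Fin._≟_ (allFin n)
allFin-enumerates (suc n) y = begin
  𝟙 (zero Fin.≟ y) + ∑[ x ∈ List.tabulate suc ] 𝟙 (x Fin.≟ y)
    ≡⟨ cong (λ xs → 𝟙 (zero Fin.≟ y) + ∑[ x ∈ xs ] 𝟙 (x Fin.≟ y)) (sym (map-tabulate (λ i → i) suc)) ⟩
  𝟙 (zero Fin.≟ y) + ∑[ x ∈ List.map suc (allFin n) ] 𝟙 (x Fin.≟ y)
    ≡⟨ cong (𝟙 (zero Fin.≟ y) +_) (∑-map suc (allFin n) _) ⟩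
  𝟙 (zero Fin.≟ y) + ∑[ x ∈ allFin n ] 𝟙 (suc x Fin.≟ y)
    ≡⟨ split y ⟩
  1 ∎
  where
  open ≡-Reasoning
  split : (y : Fin (suc n)) → 𝟙 (zero Fin.≟ y) + ∑[ x ∈ allFin n ] 𝟙 (suc x Fin.≟ y) ≡ 1
  split zero    = cong suc (∑-zero (allFin n) (λ _ → refl))
  split (suc y) = trans (∑-cong (allFin n) (λ x → 𝟙-cong (suc x Fin.≟ suc y) (x Fin.≟ y) Finₚ.suc-injective (cong suc)))
                        (allFin-enumerates n y)

map-injective : {A B : Set} {f : A → B} {n : ℕ} → (∀ {a b} → f a ≡ f b → a ≡ b) →
                {xs ys : Vec A n} → map f xs ≡ map f ys → xs ≡ ys
map-injective f-inj {xs = []}     {[]}     _       = refl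
map-injective f-inj {xs = x ∷ xs} {y ∷ ys} fxs≡fys =
  cong₂ _∷_ (f-inj (∷-injectiveˡ fxs≡fys)) (map-injective f-inj (∷-injectiveʳ fxs≡fys))

-- Fin p as the ring ℤ/pℤ

module _ (p : ℕ) .{{_ : NonZero p}} where

  private
    infixl 6 _+ₚ′_
    infixl 7 _*ₚ′_
    _+ₚ′_ : Fin p → Fin p → Fin p
    _+ₚ′_ = _+ₚ_ p
    _*ₚ′_ : Fin p → Fin p → Fin p
    _*ₚ′_ = _*ₚ_ p

  toℕ-mod : ∀ x → toℕ (x mod p) ≡ x % p
  toℕ-mod x = toℕ-fromℕ< (m%n<n x p)

  mod-cong : ∀ {x y} → x % p ≡ y % p → x mod p ≡ y mod p
  mod-cong {x} {y} x≡y = toℕ-injective (trans (toℕ-mod x) (trans x≡y (sym (toℕ-mod y))))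

  toℕ-mod-inverse : ∀ a → toℕ a mod p ≡ a
  toℕ-mod-inverse a = toℕ-injective (trans (toℕ-mod (toℕ a)) (m<n⇒m%n≡m (toℕ<n a)))

  mod-+ : ∀ x y → (x mod p) +ₚ′ (y mod p) ≡ (x + y) mod p
  mod-+ x y = mod-cong (trans (cong₂ (λ u v → (u + v) % p) (toℕ-mod x) (toℕ-mod y)) (sym (%-distribˡ-+ x y p)))

  mod-* : ∀ x y → (x mod p) *ₚ′ (y mod p) ≡ (x * y) mod p
  mod-* x y = mod-cong (trans (cong₂ (λ u v → (u * v) % p) (toℕ-mod x) (toℕ-mod y)) (sym (%-distribˡ-* x y p)))

  -- a +ₚ b is (toℕ a + toℕ b) mod p by definition, so these push a law of ℕ through _mod p
  mod-+ˡ : ∀ x b → (x mod p) +ₚ′ b ≡ (x + toℕ b) mod p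
  mod-+ˡ x b = trans (cong ((x mod p) +ₚ′_) (sym (toℕ-mod-inverse b))) (mod-+ x (toℕ b))

  mod-*ˡ : ∀ x b → (x mod p) *ₚ′ b ≡ (x * toℕ b) mod p
  mod-*ˡ x b = trans (cong ((x mod p) *ₚ′_) (sym (toℕ-mod-inverse b))) (mod-* x (toℕ b))

  mod-+ʳ : ∀ a y → a +ₚ′ (y mod p) ≡ (toℕ a + y) mod p
  mod-+ʳ a y = trans (cong (_+ₚ′ (y mod p)) (sym (toℕ-mod-inverse a))) (mod-+ (toℕ a) y)

  mod-*ʳ : ∀ a y → a *ₚ′ (y mod p) ≡ (toℕ a * y) mod p
  mod-*ʳ a y = trans (cong (_*ₚ′ (y mod p)) (sym (toℕ-mod-inverse a))) (mod-* (toℕ a) y)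

  -ₚ_ : Fin p → Fin p
  -ₚ a = (p ∸ toℕ a) mod p

  1ₚ : Fin p
  1ₚ = 1 mod p

  +ₚ-comm : ∀ a b → a +ₚ′ b ≡ b +ₚ′ a
  +ₚ-comm a b = cong (_mod p) (ℕ.+-comm (toℕ a) (toℕ b))

  *ₚ-comm : ∀ a b → a *ₚ′ b ≡ b *ₚ′ a
  *ₚ-comm a b = cong (_mod p) (ℕ.*-comm (toℕ a) (toℕ b))

  +ₚ-assoc : ∀ a b c → a +ₚ′ b +ₚ′ c ≡ a +ₚ′ (b +ₚ′ c)
  +ₚ-assoc a b c = trans (mod-+ˡ (toℕ a + toℕ b) c)
                  (trans (cong (_mod p) (ℕ.+-assoc (toℕ a) (toℕ b) (toℕ c))) (sym (mod-+ʳ a (toℕ b + toℕ c))))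

  *ₚ-assoc : ∀ a b c → a *ₚ′ b *ₚ′ c ≡ a *ₚ′ (b *ₚ′ c)
  *ₚ-assoc a b c = trans (mod-*ˡ (toℕ a * toℕ b) c)
                  (trans (cong (_mod p) (ℕ.*-assoc (toℕ a) (toℕ b) (toℕ c))) (sym (mod-*ʳ a (toℕ b * toℕ c))))

  +ₚ-identityˡ : ∀ a → 0ₚ p +ₚ′ a ≡ a
  +ₚ-identityˡ a = trans (mod-+ˡ 0 a) (toℕ-mod-inverse a)

  *ₚ-identityˡ : ∀ a → 1ₚ *ₚ′ a ≡ a
  *ₚ-identityˡ a = trans (mod-*ˡ 1 a) (trans (cong (_mod p) (ℕ.*-identityˡ (toℕ a))) (toℕ-mod-inverse a))

  -ₚ-inverseˡ : ∀ a → (-ₚ a) +ₚ′ a ≡ 0ₚ p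
  -ₚ-inverseˡ a = trans (mod-+ˡ (p ∸ toℕ a) a)
                 (mod-cong (trans (cong (_% p) (ℕ.m∸n+n≡m (ℕ.<⇒≤ (toℕ<n a))))
                                  (trans (n%n≡0 p) (sym (m*n%n≡0 0 p)))))

  *ₚ-distribˡ-+ₚ : ∀ a b c → a *ₚ′ (b +ₚ′ c) ≡ a *ₚ′ b +ₚ′ a *ₚ′ c
  *ₚ-distribˡ-+ₚ a b c = trans (mod-*ʳ a (toℕ b + toℕ c))
                        (trans (cong (_mod p) (ℕ.*-distribˡ-+ (toℕ a) (toℕ b) (toℕ c)))
                               (sym (mod-+ (toℕ a * toℕ b) (toℕ a * toℕ c))))

  +ₚ-*ₚ-isCommutativeRing : IsCommutativeRing _≡_ _+ₚ′_ _*ₚ′_ -ₚ_ (0ₚ p) 1ₚ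
  +ₚ-*ₚ-isCommutativeRing = record
    { isRing = record
      { +-isAbelianGroup = record
        { isGroup = record
          { isMonoid = record
            { isSemigroup = record { isMagma = isMagma _+ₚ′_ ; assoc = +ₚ-assoc }
            ; identity    = comm∧idˡ⇒id +ₚ-comm +ₚ-identityˡ
            }
          ; inverse = comm∧invˡ⇒inv +ₚ-comm -ₚ-inverseˡ
          ; ⁻¹-cong = cong -ₚ_
          }
        ; comm = +ₚ-comm
        }
      ; *-cong     = cong₂ _*ₚ′_
      ; *-assoc    = *ₚ-assoc
      ; *-identity = comm∧idˡ⇒id *ₚ-comm *ₚ-identityˡ
      ; distrib    = *ₚ-distribˡ-+ₚ , comm∧distrˡ⇒distrʳ *ₚ-comm *ₚ-distribˡ-+ₚ
      }
    ; *-comm = *ₚ-comm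
    }

  +ₚ-*ₚ-commutativeRing : CommutativeRing _ _
  +ₚ-*ₚ-commutativeRing = record { isCommutativeRing = +ₚ-*ₚ-isCommutativeRing }

  private
    toℕ-0ₚ : toℕ (0ₚ p) ≡ 0
    toℕ-0ₚ = trans (toℕ-mod 0) (m*n%n≡0 0 p)

  mod≡0ₚ⇒∣ : ∀ x → x mod p ≡ 0ₚ p → p ∣ x
  mod≡0ₚ⇒∣ x x≡0 = m%n≡0⇒n∣m x p (trans (sym (toℕ-mod x)) (trans (cong toℕ x≡0) toℕ-0ₚ))

  ∣toℕ⇒≡0ₚ : ∀ a → p ∣ toℕ a → a ≡ 0ₚ p
  ∣toℕ⇒≡0ₚ a p∣a =
    toℕ-injective (trans (trans (sym (m<n⇒m%n≡m (toℕ<n a))) (n∣m⇒m%n≡0 _ p p∣a)) (sym toℕ-0ₚ))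

module Fₚ (p : ℕ) .{{_ : NonZero p}} where

  open CommutativeRing (+ₚ-*ₚ-commutativeRing p) public
    using (0#; 1#; -_; +-comm; *-comm; *-assoc; +-identityˡ; *-identityˡ; zeroˡ; zeroʳ; distribˡ; -‿inverseʳ)
    renaming (_+_ to _⊕_; _*_ to _⊗_; _-_ to _⊖_)
  open import Algebra.Properties.Ring (CommutativeRing.ring (+ₚ-*ₚ-commutativeRing p)) public
    using (-0#≈0#; -1*x≈-x; -‿involutive; -‿distribˡ-*; -‿distribʳ-*; +-inverseˡ-unique; +-inverseʳ-unique;
           x∙y⁻¹≈ε⇒x≈y; x≈y⇒x∙y⁻¹≈ε; x[y-z]≈xy-xz; [y-z]x≈yx-zx)

  infixl 6 _+ᵛ_
  infixr 7 _·ᵛ_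

  _+ᵛ_ : {m : ℕ} → Vec (Fin p) m → Vec (Fin p) m → Vec (Fin p) m
  _+ᵛ_ = _+V_ p

  _·ᵛ_ : {m : ℕ} → Fin p → Vec (Fin p) m → Vec (Fin p) m
  _·ᵛ_ = _·V_ p

  0ᵛ : (m : ℕ) → Vec (Fin p) m
  0ᵛ = zeroV p

  _≟ᵛ_ : {m : ℕ} → DecidableEquality (Vec (Fin p) m)
  _≟ᵛ_ = _≟V_ p

  neg : {n : ℕ} → Vec (Fin p) n → Vec (Fin p) n
  neg = map -_

module _ (p : ℕ) .{{_ : NonZero p}} where

  open Fₚ p

  +ᵛ-identityˡ : {m : ℕ} (u : Vec (Fin p) m) → 0ᵛ m +ᵛ u ≡ u
  +ᵛ-identityˡ []      = refl
  +ᵛ-identityˡ (x ∷ u) = cong₂ _∷_ (+-identityˡ x) (+ᵛ-identityˡ u)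

  +ᵛ≡0ᵛ⇒≡-1·ᵛ : {m : ℕ} (u w : Vec (Fin p) m) → u +ᵛ w ≡ 0ᵛ m → w ≡ (- 1#) ·ᵛ u
  +ᵛ≡0ᵛ⇒≡-1·ᵛ []      []      _     = refl
  +ᵛ≡0ᵛ⇒≡-1·ᵛ (x ∷ u) (y ∷ w) u+w≡0 =
    cong₂ _∷_ (trans (+-inverseʳ-unique x y (∷-injectiveˡ u+w≡0)) (sym (-1*x≈-x x)))
              (+ᵛ≡0ᵛ⇒≡-1·ᵛ u w (∷-injectiveʳ u+w≡0))

  ·ᵛ-identityˡ : {m : ℕ} (u : Vec (Fin p) m) → 1# ·ᵛ u ≡ u
  ·ᵛ-identityˡ []      = refl
  ·ᵛ-identityˡ (x ∷ u) = cong₂ _∷_ (*-identityˡ x) (·ᵛ-identityˡ u)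

  ·ᵛ-zeroˡ : {m : ℕ} (u : Vec (Fin p) m) → 0# ·ᵛ u ≡ 0ᵛ m
  ·ᵛ-zeroˡ []      = refl
  ·ᵛ-zeroˡ (x ∷ u) = cong₂ _∷_ (zeroˡ x) (·ᵛ-zeroˡ u)

  ·ᵛ-zeroʳ : {m : ℕ} (a : Fin p) → a ·ᵛ 0ᵛ m ≡ 0ᵛ m
  ·ᵛ-zeroʳ {zero}  a = refl
  ·ᵛ-zeroʳ {suc m} a = cong₂ _∷_ (zeroʳ a) (·ᵛ-zeroʳ a)

  ·ᵛ-distribˡ : {m : ℕ} (a : Fin p) (u w : Vec (Fin p) m) → a ·ᵛ (u +ᵛ w) ≡ a ·ᵛ u +ᵛ a ·ᵛ w
  ·ᵛ-distribˡ a []      []      = refl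
  ·ᵛ-distribˡ a (x ∷ u) (y ∷ w) = cong₂ _∷_ (distribˡ a x y) (·ᵛ-distribˡ a u w)

  ·ᵛ-assoc : {m : ℕ} (a b : Fin p) (u : Vec (Fin p) m) → a ·ᵛ b ·ᵛ u ≡ (a ⊗ b) ·ᵛ u
  ·ᵛ-assoc a b []      = refl
  ·ᵛ-assoc a b (x ∷ u) = cong₂ _∷_ (sym (*-assoc a b x)) (·ᵛ-assoc a b u)

  lincomb-zero : {m k : ℕ} (vs : Vec (Vec (Fin p) m) k) → lincomb p (0ᵛ k) vs ≡ 0ᵛ m
  lincomb-zero []       = refl
  lincomb-zero (v ∷ vs) = trans (cong₂ _+ᵛ_ (·ᵛ-zeroˡ v) (lincomb-zero vs)) (+ᵛ-identityˡ _)

  ·ᵛ-lincomb : {m k : ℕ} (a : Fin p) (c : Vec (Fin p) k) (vs : Vec (Vec (Fin p) m) k) →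
               a ·ᵛ lincomb p c vs ≡ lincomb p (map (a ⊗_) c) vs
  ·ᵛ-lincomb a []       []       = ·ᵛ-zeroʳ a
  ·ᵛ-lincomb a (c ∷ cs) (v ∷ vs) =
    trans (·ᵛ-distribˡ a (c ·ᵛ v) _) (cong₂ _+ᵛ_ (·ᵛ-assoc a c v) (·ᵛ-lincomb a cs vs))

  InSpan-zero : {m k : ℕ} (vs : Vec (Vec (Fin p) m) k) → InSpan p vs (0ᵛ m)
  InSpan-zero {k = k} vs = 0ᵛ k , lincomb-zero vs

  InSpan-∷⁺ : {m k : ℕ} (u : Vec (Fin p) m) {vs : Vec (Vec (Fin p) m) k} {w : Vec (Fin p) m} →
              InSpan p vs w → InSpan p (u ∷ vs) w
  InSpan-∷⁺ u (c , Σcv≡w) = (0# ∷ c) , trans (cong (_+ᵛ _) (·ᵛ-zeroˡ u)) (trans (+ᵛ-identityˡ _) Σcv≡w)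

  LinIndep-[] : {m : ℕ} → LinIndep p {m} []
  LinIndep-[] [] _ = refl

  neg-involutive : {n : ℕ} (d : Vec (Fin p) n) → neg (neg d) ≡ d
  neg-involutive d = trans (sym (map-∘ -_ -_ d)) (trans (map-cong -‿involutive d) (map-id d))

  neg-zero : (n : ℕ) → neg (0ᵛ n) ≡ 0ᵛ n
  neg-zero n = trans (map-replicate -_ 0# n) (cong (λ z → replicate n z) -0#≈0#)

  count≡∑𝟙 : {A : Set} {P : A → Set} (P? : Decidable P) (xs : List A) → count p P? xs ≡ ∑[ x ∈ xs ] 𝟙 (P? x)
  count≡∑𝟙 P? []       = refl
  count≡∑𝟙 P? (x ∷ xs) with P? x
  ... | yes _ = cong suc (count≡∑𝟙 P? xs)
  ... | no _  = count≡∑𝟙 P? xs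

  ∑-vecsOver-suc : {A : Set} (xs : List A) (k : ℕ) (f : Vec A (suc k) → ℕ) →
                   ∑ (vecsOver p xs (suc k)) f ≡ ∑[ x ∈ xs ] ∑[ r ∈ vecsOver p xs k ] f (x ∷ r)
  ∑-vecsOver-suc xs k f = trans (∑-concatMap _ xs f) (∑-cong xs (λ x → ∑-map (x ∷_) (vecsOver p xs k) f))

  ∑-vecsOver-1 : {A : Set} (xs : List A) (k : ℕ) → ∑[ _ ∈ vecsOver p xs k ] 1 ≡ List.length xs ^ k
  ∑-vecsOver-1 xs zero    = refl
  ∑-vecsOver-1 xs (suc k) = trans (∑-vecsOver-suc xs k (λ _ → 1))
                                  (trans (∑-cong xs (λ _ → ∑-vecsOver-1 xs k)) (∑-const xs _))

  vecsOver-enumerates : {A : Set} {_≟_ : DecidableEquality A} {xs : List A} → Enumerates _≟_ xs →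
                        (k : ℕ) → Enumerates (≡-dec _≟_) (vecsOver p xs k)
  vecsOver-enumerates enum zero    []       = refl
  vecsOver-enumerates {_≟_ = _≟_} {xs} enum (suc k) (y ∷ ys) = begin
    ∑[ v ∈ vecsOver p xs (suc k) ] 𝟙 (≡-dec _≟_ v (y ∷ ys))
      ≡⟨ ∑-vecsOver-suc xs k _ ⟩
    ∑[ x ∈ xs ] ∑[ r ∈ vecsOver p xs k ] 𝟙 (≡-dec _≟_ (x ∷ r) (y ∷ ys))
      ≡⟨ ∑-cong xs (λ x → ∑-cong (vecsOver p xs k) (λ r → 𝟙-× (x ≟ y) (≡-dec _≟_ r ys))) ⟩
    ∑[ x ∈ xs ] ∑[ r ∈ vecsOver p xs k ] (𝟙 (x ≟ y) * 𝟙 (≡-dec _≟_ r ys))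
      ≡⟨ ∑-cong xs (λ x → trans (∑-*ˡ (vecsOver p xs k) (𝟙 (x ≟ y)) (λ r → 𝟙 (≡-dec _≟_ r ys)))
                                (cong (𝟙 (x ≟ y) *_) (vecsOver-enumerates enum k ys))) ⟩
    ∑[ x ∈ xs ] (𝟙 (x ≟ y) * 1)
      ≡⟨ ∑-select _≟_ xs enum y (λ _ → 1) ⟩
    1 ∎
    where open ≡-Reasoning

  allVecs-enumerates : (m : ℕ) → Enumerates _≟ᵛ_ (allVecs p m)
  allVecs-enumerates = vecsOver-enumerates (allFin-enumerates p)

  ∑-allVecs-1 : (m : ℕ) → ∑[ _ ∈ allVecs p m ] 1 ≡ p ^ m
  ∑-allVecs-1 m = trans (∑-vecsOver-1 (allFin p) m) (cong (_^ m) (length-tabulate (λ i → i)))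

  spanning⇒p^m≤p^k : {m k : ℕ} (vs : Vec (Vec (Fin p) m) k) → (∀ v → InSpan p vs v) → p ^ m ≤ p ^ k
  spanning⇒p^m≤p^k {m} {k} vs spanning = begin
    p ^ m                                                   ≡⟨ ∑-allVecs-1 m ⟨
    ∑[ _ ∈ allVecs p m ] 1                                  ≤⟨ ∑-mono-≤ (allVecs p m) hit ⟩
    ∑[ v ∈ allVecs p m ] ∑[ c ∈ allVecs p k ] 𝟙 (lc c ≟ᵛ v)  ≡⟨ ∑-comm (allVecs p m) (allVecs p k) _ ⟩
    ∑[ c ∈ allVecs p k ] ∑[ v ∈ allVecs p m ] 𝟙 (lc c ≟ᵛ v)  ≡⟨ ∑-cong (allVecs p k) (λ c → hits-once (lc c)) ⟩
    ∑[ _ ∈ allVecs p k ] 1                                  ≡⟨ ∑-allVecs-1 k ⟩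
    p ^ k ∎
    where
    open ℕ.≤-Reasoning
    lc : Vec (Fin p) k → Vec (Fin p) m
    lc c = lincomb p c vs
    hit : ∀ v → 1 ≤ ∑[ c ∈ allVecs p k ] 𝟙 (lc c ≟ᵛ v)
    hit v with c , Σcv≡v ← spanning v =
      ∑-𝟙-witness _≟ᵛ_ (allVecs p k) (allVecs-enumerates k) (λ c → lc c ≟ᵛ v) {c} Σcv≡v
    hits-once : ∀ u → ∑[ v ∈ allVecs p m ] 𝟙 (u ≟ᵛ v) ≡ 1
    hits-once = enumerates-sym _≟ᵛ_ (allVecs p m) (allVecs-enumerates m)

  ∃-∉InSpan : 1 < p → {m k : ℕ} → k < m → (vs : Vec (Vec (Fin p) m) k) → ∃ λ v → ¬ InSpan p vs v
  ∃-∉InSpan 1<p k<m vs with anyV? p (λ v → ¬? (inSpan? p vs v))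
  ... | yes v∉span = v∉span
  ... | no ∄v∉span = ⊥-elim (ℕ.<⇒≱ (ℕ.^-monoʳ-< p 1<p k<m) (spanning⇒p^m≤p^k vs spanning))
    where
    spanning : ∀ v → InSpan p vs v
    spanning v = decidable-stable (inSpan? p vs v) (λ v∉span → ∄v∉span (v , v∉span))

-- The prime field F_p

module _ (p : ℕ) .{{_ : NonZero p}} (p-prime : Prime p) where

  open Fₚ p

  1<p : 1 < p
  1<p = nonTrivial⇒n>1 p {{prime⇒nonTrivial p-prime}}

  -x*-y≡x*y : ∀ x y → - x ⊗ - y ≡ x ⊗ y
  -x*-y≡x*y x y = trans (sym (-‿distribˡ-* x (- y))) (trans (cong -_ (sym (-‿distribʳ-* x y))) (-‿involutive (x ⊗ y)))

  x*y≡0⇒x≡0∨y≡0 : ∀ x y → x ⊗ y ≡ 0# → x ≡ 0# ⊎ y ≡ 0#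
  x*y≡0⇒x≡0∨y≡0 x y xy≡0 =
    Sum.map (∣toℕ⇒≡0ₚ p x) (∣toℕ⇒≡0ₚ p y) (euclidsLemma (toℕ x) (toℕ y) p-prime (mod≡0ₚ⇒∣ p _ xy≡0))

  *-cancelˡ-≢0 : ∀ {x} y z → x ≢ 0# → x ⊗ y ≡ x ⊗ z → y ≡ z
  *-cancelˡ-≢0 {x} y z x≢0 xy≡xz
    with x*y≡0⇒x≡0∨y≡0 x (y ⊖ z) (trans (x[y-z]≈xy-xz x y z) (x≈y⇒x∙y⁻¹≈ε xy≡xz))
  ... | inj₁ x≡0   = ⊥-elim (x≢0 x≡0)
  ... | inj₂ y-z≡0 = x∙y⁻¹≈ε⇒x≈y y z y-z≡0

  x*x≡y*y⇒y≡x∨y≡-x : ∀ x y → x ⊗ x ≡ y ⊗ y → y ≡ x ⊎ y ≡ - x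
  x*x≡y*y⇒y≡x∨y≡-x x y xx≡yy =
    Sum.map (x∙y⁻¹≈ε⇒x≈y y x) (+-inverseˡ-unique y x) (x*y≡0⇒x≡0∨y≡0 (y ⊖ x) (y ⊕ x) [y-x][y+x]≡0)
    where
    open ≡-Reasoning
    [y-x][y+x]≡0 : (y ⊖ x) ⊗ (y ⊕ x) ≡ 0#
    [y-x][y+x]≡0 = begin
      (y ⊖ x) ⊗ (y ⊕ x)                   ≡⟨ [y-z]x≈yx-zx (y ⊕ x) y x ⟩
      y ⊗ (y ⊕ x) ⊖ x ⊗ (y ⊕ x)           ≡⟨ cong₂ _⊖_ (distribˡ y y x) (distribˡ x y x) ⟩
      (y ⊗ y ⊕ y ⊗ x) ⊖ (x ⊗ y ⊕ x ⊗ x)   ≡⟨ cong₂ (λ u v → (u ⊕ v) ⊖ (x ⊗ y ⊕ x ⊗ x)) (sym xx≡yy) (*-comm y x) ⟩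
      (x ⊗ x ⊕ x ⊗ y) ⊖ (x ⊗ y ⊕ x ⊗ x)   ≡⟨ cong (λ u → (x ⊗ x ⊕ x ⊗ y) ⊖ u) (+-comm (x ⊗ y) (x ⊗ x)) ⟩
      (x ⊗ x ⊕ x ⊗ y) ⊖ (x ⊗ x ⊕ x ⊗ y)   ≡⟨ -‿inverseʳ _ ⟩
      0# ∎

  private
    toℕ≢0 : ∀ {a} → a ≢ 0# → toℕ a ≢ 0
    toℕ≢0 a≢0 ta≡0 = a≢0 (∣toℕ⇒≡0ₚ p _ (subst (p ∣_) (sym ta≡0) (p ∣0)))

  *-inverseˡ : ∀ a → a ≢ 0# → ∃ λ b → b ⊗ a ≡ 1#
  *-inverseˡ a a≢0 with coprime-Bézout (prime⇒coprime p-prime {{≢-nonZero (toℕ≢0 a≢0)}} (toℕ<n a))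
  ... | Bézout.-+ x y 1+xp≡yta = y mod p , (begin
    (y mod p) ⊗ a        ≡⟨ mod-*ˡ p y a ⟩
    (y * toℕ a) mod p    ≡⟨ cong (_mod p) (sym 1+xp≡yta) ⟩
    (1 + x * p) mod p    ≡⟨ mod-cong p (%-remove-+ʳ 1 (divides x refl)) ⟩
    1# ∎)
    where open ≡-Reasoning
  ... | Bézout.+- x y 1+yta≡xp = - (y mod p) , (begin
    - (y mod p) ⊗ a      ≡⟨ sym (-‿distribˡ-* (y mod p) a) ⟩
    - ((y mod p) ⊗ a)    ≡⟨ sym (+-inverseˡ-unique 1# _ 1+ya≡0) ⟩
    1# ∎)
    where
    open ≡-Reasoning
    1+ya≡0 : 1# ⊕ (y mod p) ⊗ a ≡ 0#
    1+ya≡0 = begin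
      1# ⊕ (y mod p) ⊗ a          ≡⟨ cong (1# ⊕_) (mod-*ˡ p y a) ⟩
      1# ⊕ (y * toℕ a) mod p      ≡⟨ mod-+ p 1 (y * toℕ a) ⟩
      (1 + y * toℕ a) mod p       ≡⟨ cong (_mod p) 1+yta≡xp ⟩
      (x * p) mod p               ≡⟨ mod-cong p (trans (m*n%n≡0 x p) (sym (m*n%n≡0 0 p))) ⟩
      0# ∎

  x≡-x⇒x≡0 : p ≢ 2 → ∀ {x} → x ≡ - x → x ≡ 0#
  x≡-x⇒x≡0 p≢2 {x} x≡-x with euclidsLemma 2 (toℕ x) p-prime p∣2x
    where
    x+x≡0 : x ⊕ x ≡ 0#
    x+x≡0 = trans (cong (x ⊕_) x≡-x) (-‿inverseʳ x)
    p∣2x : p ∣ 2 * toℕ x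
    p∣2x = subst (p ∣_) (cong (toℕ x +_) (sym (ℕ.+-identityʳ (toℕ x)))) (mod≡0ₚ⇒∣ p _ x+x≡0)
  ... | inj₁ p∣2 = ⊥-elim (p≢2 (ℕ.≤-antisym (∣⇒≤ p∣2) 1<p))
  ... | inj₂ p∣x = ∣toℕ⇒≡0ₚ p x p∣x

  LinIndep-∷ : {m k : ℕ} {v : Vec (Fin p) m} {vs : Vec (Vec (Fin p) m) k} →
               LinIndep p vs → ¬ InSpan p vs v → LinIndep p (v ∷ vs)
  LinIndep-∷ {v = v} {vs} indep v∉span (c ∷ cs) cv+Σ≡0 with c Fin.≟ 0#
  ... | yes refl = cong (0# ∷_) (indep cs (trans (sym 0v+Σ≡Σ) cv+Σ≡0))
    where
    0v+Σ≡Σ : 0# ·ᵛ v +ᵛ lincomb p cs vs ≡ lincomb p cs vs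
    0v+Σ≡Σ = trans (cong (_+ᵛ _) (·ᵛ-zeroˡ p v)) (+ᵛ-identityˡ p _)
  ... | no c≢0 with i , ic≡1 ← *-inverseˡ c c≢0 = ⊥-elim (v∉span (map (- i ⊗_) cs , Σ≡v))
    where
    open ≡-Reasoning
    Σ≡v : lincomb p (map (- i ⊗_) cs) vs ≡ v
    Σ≡v = begin
      lincomb p (map (- i ⊗_) cs) vs  ≡⟨ ·ᵛ-lincomb p (- i) cs vs ⟨
      - i ·ᵛ lincomb p cs vs          ≡⟨ cong (- i ·ᵛ_) (+ᵛ≡0ᵛ⇒≡-1·ᵛ p (c ·ᵛ v) _ cv+Σ≡0) ⟩
      - i ·ᵛ - 1# ·ᵛ c ·ᵛ v           ≡⟨ cong (- i ·ᵛ_) (·ᵛ-assoc p (- 1#) c v) ⟩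
      - i ·ᵛ (- 1# ⊗ c) ·ᵛ v          ≡⟨ ·ᵛ-assoc p (- i) _ v ⟩
      (- i ⊗ (- 1# ⊗ c)) ·ᵛ v         ≡⟨ cong (λ a → (- i ⊗ a) ·ᵛ v) (-1*x≈-x c) ⟩
      (- i ⊗ - c) ·ᵛ v                ≡⟨ cong (_·ᵛ v) (trans (-x*-y≡x*y i c) ic≡1) ⟩
      1# ·ᵛ v                         ≡⟨ ·ᵛ-identityˡ p v ⟩
      v ∎

  LinIndep-extend : {m k : ℕ} (N : ℕ) → k ≤ N → N ≤ m → {vs : Vec (Vec (Fin p) m) k} → LinIndep p vs →
                    ∃ λ (ws : Vec (Vec (Fin p) m) N) → LinIndep p ws × InSpan p vs ⊆ InSpan p ws
  LinIndep-extend zero z≤n _ {vs} indep = vs , indep , λ v∈span → v∈span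
  LinIndep-extend (suc N) k≤1+N 1+N≤m {vs} indep with ℕ.m≤n⇒m<n∨m≡n k≤1+N
  ... | inj₂ refl = vs , indep , λ v∈span → v∈span
  ... | inj₁ (s≤s k≤N)
    with ws , indep-ws , vs⊆ws ← LinIndep-extend N k≤N (ℕ.<⇒≤ 1+N≤m) indep
    with w , w∉span ← ∃-∉InSpan p 1<p 1+N≤m ws
    = (w ∷ ws) , LinIndep-∷ indep-ws w∉span , λ v∈span → InSpan-∷⁺ p w (vs⊆ws v∈span)

  -- The Veronese map

  d≡neg-d⇒d≡0 : p ≢ 2 → {n : ℕ} {d : Vec (Fin p) n} → d ≡ neg d → d ≡ 0ᵛ n
  d≡neg-d⇒d≡0 p≢2 {d = []}    _      = refl
  d≡neg-d⇒d≡0 p≢2 {d = x ∷ d} d≡-d =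
    cong₂ _∷_ (x≡-x⇒x≡0 p≢2 (∷-injectiveˡ d≡-d)) (d≡neg-d⇒d≡0 p≢2 (∷-injectiveʳ d≡-d))

  φ-neg : {n : ℕ} (d : Vec (Fin p) n) → φ p (neg d) ≡ φ p d
  φ-neg []       = refl
  φ-neg (x ∷ xs) = cong₂ _++_
    (cong₂ _∷_ (-x*-y≡x*y x x) (trans (sym (map-∘ (- x ⊗_) -_ xs)) (map-cong (-x*-y≡x*y x) xs)))
    (φ-neg xs)

  φ-zero : (n : ℕ) → φ p (0ᵛ n) ≡ 0ᵛ (tri p n)
  φ-zero zero    = refl
  φ-zero (suc n) = trans (cong₂ _++_ (cong₂ _∷_ (zeroˡ 0#) 0·0≡0) (φ-zero n)) (sym (replicate-++ (suc n) (tri p n)))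
    where
    0·0≡0 : map (0# ⊗_) (0ᵛ n) ≡ 0ᵛ n
    0·0≡0 = trans (map-replicate (0# ⊗_) 0# n) (cong (replicate n) (zeroˡ 0#))
    replicate-++ : ∀ a b → replicate (a + b) 0# ≡ replicate a 0# ++ replicate b 0#
    replicate-++ zero    b = refl
    replicate-++ (suc a) b = cong (0# ∷_) (replicate-++ a b)

  φ-∷-injective : {n : ℕ} (x y : Fin p) (xs ys : Vec (Fin p) n) → φ p (x ∷ xs) ≡ φ p (y ∷ ys) →
                  x ⊗ x ≡ y ⊗ y × map (x ⊗_) xs ≡ map (y ⊗_) ys × φ p xs ≡ φ p ys
  φ-∷-injective x y xs ys φ≡φ with ++-injective ((x ⊗ x) ∷ map (x ⊗_) xs) ((y ⊗ y) ∷ map (y ⊗_) ys) φ≡φ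
  ... | head≡head , tail≡tail = ∷-injectiveˡ head≡head , ∷-injectiveʳ head≡head , tail≡tail

  φ-fibre : {n : ℕ} (d e : Vec (Fin p) n) → φ p d ≡ φ p e → e ≡ d ⊎ e ≡ neg d
  φ-fibre-sameHead : {n : ℕ} (x : Fin p) (xs ys : Vec (Fin p) n) → φ p (x ∷ xs) ≡ φ p (x ∷ ys) →
                     x ∷ ys ≡ x ∷ xs ⊎ x ∷ ys ≡ neg (x ∷ xs)

  φ-fibre []       []       _    = inj₁ refl
  φ-fibre (x ∷ xs) (y ∷ ys) φ≡φ with x*x≡y*y⇒y≡x∨y≡-x x y (proj₁ (φ-∷-injective x y xs ys φ≡φ))
  ... | inj₁ refl = φ-fibre-sameHead x xs ys φ≡φ
  ... | inj₂ refl with φ-fibre-sameHead x xs (neg ys) φ≡φ′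
    where
    φ≡φ′ : φ p (x ∷ xs) ≡ φ p (x ∷ neg ys)
    φ≡φ′ = trans φ≡φ (trans (cong (λ zs → φ p (- x ∷ zs)) (sym (neg-involutive p ys))) (φ-neg (x ∷ neg ys)))
  ... | inj₁ e′≡d     = inj₂ (trans (cong (- x ∷_) (sym (neg-involutive p ys))) (cong neg e′≡d))
  ... | inj₂ e′≡neg-d = inj₁ (trans (cong (- x ∷_) (sym (neg-involutive p ys)))
                                    (trans (cong neg e′≡neg-d) (neg-involutive p (x ∷ xs))))

  φ-fibre-sameHead x xs ys φ≡φ with x Fin.≟ 0# | φ-∷-injective x x xs ys φ≡φ
  ... | yes refl | _ , _ , φxs≡φys = Sum.map (cong (0# ∷_)) (cong₂ _∷_ (sym -0#≈0#)) (φ-fibre xs ys φxs≡φys)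
  ... | no x≢0   | _ , xxs≡xys , _ = inj₁ (cong (x ∷_) (sym (map-injective (*-cancelˡ-≢0 _ _ x≢0) xxs≡xys)))

  φ≡0⇒≡0 : {n : ℕ} (d : Vec (Fin p) n) → φ p d ≡ 0ᵛ (tri p n) → d ≡ 0ᵛ n
  φ≡0⇒≡0 {n} d φd≡0 with φ-fibre (0ᵛ n) d (trans (φ-zero n) (sym φd≡0))
  ... | inj₁ d≡0   = d≡0
  ... | inj₂ d≡-0 = trans d≡-0 (neg-zero p n)

  fibreSize : (n : ℕ) → Vec (Fin p) (tri p n) → ℕ
  fibreSize n b = ∑[ d ∈ allVecs p n ] 𝟙 (φ p d ≟ᵛ b)

  fibreSize+[b≡0]≡2*[b∈Imφ] : p ≢ 2 → (n : ℕ) (b : Vec (Fin p) (tri p n)) →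
                              fibreSize n b + 𝟙 (b ≟ᵛ 0ᵛ (tri p n)) ≡ 2 * 𝟙 (inImφ? p {n} b)
  fibreSize+[b≡0]≡2*[b∈Imφ] p≢2 n b with inImφ? p {n} b
  ... | no b∉Im = cong₂ _+_ (∑-zero (allVecs p n) (λ d → 𝟙-no (φ p d ≟ᵛ b) (λ φd≡b → b∉Im (d , φd≡b))))
                            (𝟙-no (b ≟ᵛ 0ᵛ _) (λ b≡0 → b∉Im (0ᵛ n , trans (φ-zero n) (sym b≡0))))
  ... | yes (e , refl) with e ≟ᵛ 0ᵛ n
  ...   | yes refl = cong₂ _+_ fibre-0 (𝟙-yes (φ p (0ᵛ n) ≟ᵛ 0ᵛ _) (φ-zero n))
    where
    fibre-0 : fibreSize n (φ p (0ᵛ n)) ≡ 1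
    fibre-0 = trans (∑-cong (allVecs p n) (λ d → 𝟙-cong (φ p d ≟ᵛ φ p (0ᵛ n)) (d ≟ᵛ 0ᵛ n)
                      (λ φd≡φ0 → φ≡0⇒≡0 d (trans φd≡φ0 (φ-zero n))) (cong (φ p))))
                    (allVecs-enumerates p n (0ᵛ n))
  ...   | no e≢0 = cong₂ _+_ fibre-e (𝟙-no (φ p e ≟ᵛ 0ᵛ _) (λ φe≡0 → e≢0 (φ≡0⇒≡0 e φe≡0)))
    where
    open ≡-Reasoning
    e≢neg-e : ∀ {d} → d ≡ e → d ≡ neg e → ⊥
    e≢neg-e refl e≡-e = e≢0 (d≡neg-d⇒d≡0 p≢2 e≡-e)
    fibre-e : fibreSize n (φ p e) ≡ 2
    fibre-e = begin
      fibreSize n (φ p e)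
        ≡⟨ ∑-cong (allVecs p n) (λ d → 𝟙-cong (φ p d ≟ᵛ φ p e) ((d ≟ᵛ e) ⊎-dec (d ≟ᵛ neg e))
             (λ φd≡φe → φ-fibre e d (sym φd≡φe))
             (Sum.[ cong (φ p) , (λ d≡-e → trans (cong (φ p) d≡-e) (φ-neg e)) ])) ⟩
      ∑[ d ∈ allVecs p n ] 𝟙 ((d ≟ᵛ e) ⊎-dec (d ≟ᵛ neg e))
        ≡⟨ ∑-cong (allVecs p n) (λ d → 𝟙-⊎ (d ≟ᵛ e) (d ≟ᵛ neg e) (uncurry e≢neg-e)) ⟩
      ∑[ d ∈ allVecs p n ] (𝟙 (d ≟ᵛ e) + 𝟙 (d ≟ᵛ neg e))
        ≡⟨ ∑-+ (allVecs p n) _ _ ⟩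
      ∑[ d ∈ allVecs p n ] 𝟙 (d ≟ᵛ e) + ∑[ d ∈ allVecs p n ] 𝟙 (d ≟ᵛ neg e)
        ≡⟨ cong₂ _+_ (allVecs-enumerates p n e) (allVecs-enumerates p n (neg e)) ⟩
      2 ∎

  -- Counting

  module _ (n : ℕ) {k : ℕ} (V : Vec (Vec (Fin p) (tri p n)) k) where

    private
      m : ℕ
      m = tri p n
      [_∈span] : Vec (Fin p) m → ℕ
      [ b ∈span] = 𝟙 (inSpan? p V b)
      [_∉span] : Vec (Fin p) m → ℕ
      [ b ∉span] = 𝟙 (¬? (inSpan? p V b))
      [_∈Imφ] : Vec (Fin p) m → ℕ
      [ b ∈Imφ] = 𝟙 (inImφ? p {n} b)

    preimCount≡∑fibreSize : preimCount p n V ≡ ∑[ b ∈ allVecs p m ] (fibreSize n b * [ b ∈span])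
    preimCount≡∑fibreSize = begin
      preimCount p n V
        ≡⟨ count≡∑𝟙 p (λ d → inSpan? p V (φ p d)) (allVecs p n) ⟩
      ∑[ d ∈ allVecs p n ] [ φ p d ∈span]
        ≡⟨ ∑-cong (allVecs p n) (λ d → ∑-select _≟ᵛ_ (allVecs p m) (allVecs-enumerates p m) (φ p d) [_∈span]) ⟨
      ∑[ d ∈ allVecs p n ] ∑[ b ∈ allVecs p m ] (𝟙 (b ≟ᵛ φ p d) * [ b ∈span])
        ≡⟨ ∑-comm (allVecs p n) (allVecs p m) _ ⟩
      ∑[ b ∈ allVecs p m ] ∑[ d ∈ allVecs p n ] (𝟙 (b ≟ᵛ φ p d) * [ b ∈span])
        ≡⟨ ∑-cong (allVecs p m) fibre ⟩
      ∑[ b ∈ allVecs p m ] (fibreSize n b * [ b ∈span]) ∎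
      where
      open ≡-Reasoning
      fibre : ∀ b → ∑[ d ∈ allVecs p n ] (𝟙 (b ≟ᵛ φ p d) * [ b ∈span]) ≡ fibreSize n b * [ b ∈span]
      fibre b = trans (∑-cong (allVecs p n)
                        (λ d → cong (_* [ b ∈span]) (𝟙-cong (b ≟ᵛ φ p d) (φ p d ≟ᵛ b) sym sym)))
                      (∑-*ʳ (allVecs p n) _ [ b ∈span])

    preimCount+1≡2*imHits : p ≢ 2 → preimCount p n V + 1 ≡ 2 * imHits p n V
    preimCount+1≡2*imHits p≢2 = begin
      preimCount p n V + 1
        ≡⟨ cong₂ _+_ preimCount≡∑fibreSize 1≡[0∈span] ⟩
      ∑[ b ∈ allVecs p m ] (fibreSize n b * [ b ∈span]) + ∑[ b ∈ allVecs p m ] (𝟙 (b ≟ᵛ 0ᵛ m) * [ b ∈span])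
        ≡⟨ ∑-+ (allVecs p m) _ _ ⟨
      ∑[ b ∈ allVecs p m ] (fibreSize n b * [ b ∈span] + 𝟙 (b ≟ᵛ 0ᵛ m) * [ b ∈span])
        ≡⟨ ∑-cong (allVecs p m) (λ b → sym (ℕ.*-distribʳ-+ [ b ∈span] (fibreSize n b) _)) ⟩
      ∑[ b ∈ allVecs p m ] ((fibreSize n b + 𝟙 (b ≟ᵛ 0ᵛ m)) * [ b ∈span])
        ≡⟨ ∑-cong (allVecs p m) (λ b → cong (_* [ b ∈span]) (fibreSize+[b≡0]≡2*[b∈Imφ] p≢2 n b)) ⟩
      ∑[ b ∈ allVecs p m ] (2 * [ b ∈Imφ] * [ b ∈span])
        ≡⟨ ∑-cong (allVecs p m) (λ b → trans (ℕ.*-assoc 2 [ b ∈Imφ] _) (cong (2 *_) (ℕ.*-comm [ b ∈Imφ] _))) ⟩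
      ∑[ b ∈ allVecs p m ] (2 * ([ b ∈span] * [ b ∈Imφ]))
        ≡⟨ ∑-*ˡ (allVecs p m) 2 _ ⟩
      2 * ∑[ b ∈ allVecs p m ] ([ b ∈span] * [ b ∈Imφ])
        ≡⟨ cong (2 *_) (∑-cong (allVecs p m) (λ b → 𝟙-× (inSpan? p V b) (inImφ? p {n} b))) ⟨
      2 * ∑[ b ∈ allVecs p m ] 𝟙 (inSpan? p V b ×-dec inImφ? p {n} b)
        ≡⟨ cong (2 *_) (count≡∑𝟙 p (λ b → inSpan? p V b ×-dec inImφ? p {n} b) (allVecs p m)) ⟨
      2 * imHits p n V ∎
      where
      open ≡-Reasoning
      1≡[0∈span] : 1 ≡ ∑[ b ∈ allVecs p m ] (𝟙 (b ≟ᵛ 0ᵛ m) * [ b ∈span])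
      1≡[0∈span] = sym (trans (∑-select _≟ᵛ_ (allVecs p m) (allVecs-enumerates p m) (0ᵛ m) [_∈span])
                              (𝟙-yes (inSpan? p V (0ᵛ m)) (InSpan-zero p V)))

    ∑[φd∉span]≡p^n∸preimCount : ∑[ d ∈ allVecs p n ] [ φ p d ∉span] ≡ p ^ n ∸ preimCount p n V
    ∑[φd∉span]≡p^n∸preimCount = begin
      ∑[ d ∈ allVecs p n ] [ φ p d ∉span]                               ≡⟨ ℕ.m+n∸m≡n (preimCount p n V) _ ⟨
      preimCount p n V + ∑[ d ∈ allVecs p n ] [ φ p d ∉span] ∸ preimCount p n V
        ≡⟨ cong (λ c → c + ∑[ d ∈ allVecs p n ] [ φ p d ∉span] ∸ preimCount p n V) (count≡∑𝟙 p _ (allVecs p n)) ⟩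
      ∑[ d ∈ allVecs p n ] [ φ p d ∈span] + ∑[ d ∈ allVecs p n ] [ φ p d ∉span] ∸ preimCount p n V
        ≡⟨ cong (_∸ preimCount p n V) (∑-+ (allVecs p n) _ _) ⟨
      ∑[ d ∈ allVecs p n ] ([ φ p d ∈span] + [ φ p d ∉span]) ∸ preimCount p n V
        ≡⟨ cong (_∸ preimCount p n V) (trans (∑-cong (allVecs p n) (λ d → 𝟙-+-¬ (inSpan? p V (φ p d)))) (∑-allVecs-1 p n)) ⟩
      p ^ n ∸ preimCount p n V ∎
      where open ≡-Reasoning

  preimCount-mono : (n : ℕ) {k k′ : ℕ} {V : Vec (Vec (Fin p) (tri p n)) k} {V′ : Vec (Vec (Fin p) (tri p n)) k′} →
                    InSpan p V ⊆ InSpan p V′ → preimCount p n V ≤ preimCount p n V′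
  preimCount-mono n {V = V} {V′} V⊆V′ =
    subst₂ _≤_ (sym (count≡∑𝟙 p _ (allVecs p n))) (sym (count≡∑𝟙 p _ (allVecs p n)))
      (∑-mono-≤ (allVecs p n) (λ d → 𝟙-mono (inSpan? p V (φ p d)) (inSpan? p V′ (φ p d)) V⊆V′))

  module _ (n : ℕ) where

    private
      Indep? : {k : ℕ} (ds : Vec (Vec (Fin p) n) k) → Dec (LinIndep p (map (φ p) ds))
      Indep? ds = linIndep? p (map (φ p) ds)

    a*indepCount≤indepCount-suc :
      (a : ℕ) {k : ℕ} →
      ((ds : Vec (Vec (Fin p) n) k) → LinIndep p (map (φ p) ds) → a ≤ p ^ n ∸ preimCount p n (map (φ p) ds)) →
      a * indepCount p n k ≤ indepCount p n (suc k)
    a*indepCount≤indepCount-suc a {k} a≤#avoiding = begin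
      a * indepCount p n k
        ≡⟨ cong (a *_) (count≡∑𝟙 p Indep? (T k)) ⟩
      a * ∑[ ds ∈ T k ] 𝟙 (Indep? ds)
        ≡⟨ ∑-*ˡ (T k) a _ ⟨
      ∑[ ds ∈ T k ] (a * 𝟙 (Indep? ds))
        ≤⟨ ∑-mono-≤ (T k) a*[indep]≤[indep]*#avoiding ⟩
      ∑[ ds ∈ T k ] (𝟙 (Indep? ds) * ∑[ x ∈ allVecs p n ] [ x ∉span ds ])
        ≡⟨ ∑-cong (T k) (λ ds → ∑-*ˡ (allVecs p n) (𝟙 (Indep? ds)) _) ⟨
      ∑[ ds ∈ T k ] ∑[ x ∈ allVecs p n ] (𝟙 (Indep? ds) * [ x ∉span ds ])
        ≡⟨ ∑-comm (T k) (allVecs p n) _ ⟩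
      ∑[ x ∈ allVecs p n ] ∑[ ds ∈ T k ] (𝟙 (Indep? ds) * [ x ∉span ds ])
        ≤⟨ ∑-mono-≤ (allVecs p n) (λ x → ∑-mono-≤ (T k) (λ ds →
             𝟙-*-≤ (Indep? ds) (¬? (inSpan? p (map (φ p) ds) (φ p x))) (Indep? (x ∷ ds)) LinIndep-∷)) ⟩
      ∑[ x ∈ allVecs p n ] ∑[ ds ∈ T k ] 𝟙 (Indep? (x ∷ ds))
        ≡⟨ ∑-vecsOver-suc p (allVecs p n) k _ ⟨
      ∑[ ds ∈ T (suc k) ] 𝟙 (Indep? ds)
        ≡⟨ count≡∑𝟙 p Indep? (T (suc k)) ⟨
      indepCount p n (suc k) ∎
      where
      open ℕ.≤-Reasoning
      T : (k : ℕ) → List (Vec (Vec (Fin p) n) k)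
      T = vecsOver p (allVecs p n)
      [_∉span_] : Vec (Fin p) n → Vec (Vec (Fin p) n) k → ℕ
      [ x ∉span ds ] = 𝟙 (¬? (inSpan? p (map (φ p) ds) (φ p x)))
      a*[indep]≤[indep]*#avoiding : ∀ ds → a * 𝟙 (Indep? ds) ≤ 𝟙 (Indep? ds) * ∑[ x ∈ allVecs p n ] [ x ∉span ds ]
      a*[indep]≤[indep]*#avoiding ds with Indep? ds
      ... | no _      = ℕ.≤-reflexive (ℕ.*-zeroʳ a)
      ... | yes indep = begin
        a * 1                                      ≡⟨ ℕ.*-identityʳ a ⟩
        a                                          ≤⟨ a≤#avoiding ds indep ⟩
        p ^ n ∸ preimCount p n (map (φ p) ds)      ≡⟨ ∑[φd∉span]≡p^n∸preimCount n (map (φ p) ds) ⟨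
        ∑[ x ∈ allVecs p n ] [ x ∉span ds ]        ≡⟨ ℕ.+-identityʳ _ ⟨
        1 * ∑[ x ∈ allVecs p n ] [ x ∉span ds ]    ∎

  indepCount-zero : (n : ℕ) → indepCount p n 0 ≡ 1
  indepCount-zero n = trans (count≡∑𝟙 p (λ (ds : Vec (Vec (Fin p) n) 0) → linIndep? p (map (φ p) ds)) ([] ∷ []))
                            (cong (_+ 0) (𝟙-yes (linIndep? p {tri p n} []) (LinIndep-[] p)))

  MaximisesImHits : (n : ℕ) {N : ℕ} → Vec (Vec (Fin p) (tri p n)) N → Set
  MaximisesImHits n {N} W = (W′ : Vec (Vec (Fin p) (tri p n)) N) → LinIndep p W′ → imHits p n W′ ≤ imHits p n W

  module _ (p≢2 : p ≢ 2) (n : ℕ) {N : ℕ} (N≤tri : N ≤ tri p n)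
           {W : Vec (Vec (Fin p) (tri p n)) N} (W-max : MaximisesImHits n W) where

    preimCount≤preimCount-maximiser : {k : ℕ} → k ≤ N → {V : Vec (Vec (Fin p) (tri p n)) k} → LinIndep p V →
                                      preimCount p n V ≤ preimCount p n W
    preimCount≤preimCount-maximiser k≤N indep with V′ , indep′ , V⊆V′ ← LinIndep-extend _ k≤N N≤tri indep =
      ℕ.≤-trans (preimCount-mono n V⊆V′) (ℕ.+-cancelʳ-≤ 1 _ _ (begin
        preimCount p n V′ + 1   ≡⟨ preimCount+1≡2*imHits n V′ p≢2 ⟩
        2 * imHits p n V′       ≤⟨ ℕ.*-monoʳ-≤ 2 (W-max V′ indep′) ⟩
        2 * imHits p n W        ≡⟨ preimCount+1≡2*imHits n W p≢2 ⟨
        preimCount p n W + 1    ∎))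
      where open ℕ.≤-Reasoning

    [p^n∸preimCount]^k≤indepCount : (k : ℕ) → k ≤ N → (p ^ n ∸ preimCount p n W) ^ k ≤ indepCount p n k
    [p^n∸preimCount]^k≤indepCount zero    _     = ℕ.≤-reflexive (sym (indepCount-zero n))
    [p^n∸preimCount]^k≤indepCount (suc k) 1+k≤N = ℕ.≤-trans
      (ℕ.*-monoʳ-≤ a ([p^n∸preimCount]^k≤indepCount k k≤N))
      (a*indepCount≤indepCount-suc n a (λ _ indep → ℕ.∸-monoʳ-≤ (p ^ n) (preimCount≤preimCount-maximiser k≤N indep)))
      where
      k≤N : k ≤ N
      k≤N = ℕ.<⇒≤ 1+k≤N
      a : ℕ
      a = p ^ n ∸ preimCount p n W

lemma3p4 : (p n N : ℕ) .{{_ : NonZero p}} → Prime p → p ≢ 2 →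
    1 ≤ n → 1 ≤ N → N ≤ tri p n →
    (W : Vec (Vec (Fin p) (tri p n)) N) → LinIndep p W →
    ((W′ : Vec (Vec (Fin p) (tri p n)) N) → LinIndep p W′ → imHits p n W′ ≤ imHits p n W) →
    (p ^ n ∸ preimCount p n W) ^ N ≤ indepCount p n N
lemma3p4 p n N p-prime p≢2 _ _ N≤tri W _ W-max =
  [p^n∸preimCount]^k≤indepCount p p-prime p≢2 n N≤tri W-max N ℕ.≤-refl
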